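{- Let $\Phi$ be an $\mathcal{ALCQIO}_{b,Re}$-formula over a vocabulary $\tau$. There exists an $\mathcal{ALCQIO}_b$-formula $semi(\Phi)$ over $\tau$ such that for every (finite) $\tau$-structure $\mathcal M$: $\mathcal M\models semi(\Phi)$ iff $\mathcal M$ is $\Phi$-semi-connected.
   Context: Vocabularies contain atomic concepts, atomic roles (a subset $\mathsf{N_F}$ functional, interpreted as partial functions) and nominals; structures are finite. $\mathcal{ALCQIO}_b$ formulae are Boolean combinations of concept inclusions $C\sqsubseteq D$ between concepts built from atomic concepts and nominals by $\sqcap,\sqcup,\neg,\exists r.C,\exists^{\le n}r.C$ ($r$ an atomic role or inverse), standard semantics. An $\mathcal{ALCQIO}_{b,Re}$-formula is $\Phi=\varphi\land\bigwedge RE\land\bigwedge DI$ with $\varphi\in\mathcal{ALCQIO}_b$, $RE=\{Reach(B_{h'},S_{h'},A_{h'}):1\le h'\le h\}$ a set of reachability assertions ($A_{h'},B_{h'}$ atomic concepts, $S_{h'}\subseteq\mathsf{N_F}$) and $DI$ a set of disjointness assertions $A_1\sqcap A_2\equiv\bot$, compatible (distinct assertions of $RE$ with intersecting role sets have their $A$-concepts declared disjoint in $DI$). $assoc(\Phi)=\varphi\land\bigwedge_{h'}(B_{h'}\sqsubseteq A_{h'})\land\bigwedge DI$. $D^{\mathcal M}_{h'}$ is the directed graph with vertex set $A_{h'}^{\mathcal M}$ and edges $\left(\bigcup_{s\in S_{h'}}s^{\mathcal M}\right)\cap(A_{h'}^{\mathcal M})^2$. $\mathcal M$ is $\Phi$-semi-connected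 if $\mathcal M\models assoc(\Phi)$ and for every $h'$ and every $u\in A_{h'}^{\mathcal M}$, $u$ is reachable in $D_{h'}^{\mathcal M}$ from a vertex of $B_{h'}^{\mathcal M}$ or from a vertex lying on a directed cycle of $D_{h'}^{\mathcal M}$. -}

module Defs where

open import Data.Nat using (ℕ; suc; _≤ᵇ_)
open import Data.Bool using (Bool; true; false; _∧_; _∨_; not)
open import Data.Fin using (Fin)
open import Data.Fin.Subset using (Subset; _∈_; _⊆_)
open import Data.List using (List; length; filterᵇ; allFin)
open import Data.Product using (Σ; ∃; _×_; _,_)
open import Data.Sum using (_⊎_)
open import Relation.Nullary using (¬_)
open import Relation.Binary.PropositionalEquality using (_≡_)
open import Relation.Binary.Construct.Closure.ReflexiveTransitive using (Star)
open import Relation.Binary.Construct.Closure.Transitive using (TransClosure)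

record Vocab : Set where
  field
    nC : ℕ
    nR : ℕ
    nN : ℕ
    NF : Subset nR   -- functional roles
open Vocab public

-- Finite τ-structures (domain Fin (suc size), i.e. finite non-empty).

record Structure (τ : Vocab) : Set where
  field
    size : ℕ
    conc : Fin (nC τ) → Fin (suc size) → Bool
    role : Fin (nR τ) → Fin (suc size) → Fin (suc size) → Bool
    nom  : Fin (nN τ) → Fin (suc size)
    functional : ∀ r → r ∈ NF τ → ∀ x y z →
                 role r x y ≡ true → role r x z ≡ true → y ≡ z
open Structure public

Dom : ∀ {τ} → Structure τ → Set
Dom M = Fin (suc (size M))

data Role (τ : Vocab) : Set where
  rn  : Fin (nR τ) → Role τ
  inv : Fin (nR τ) → Role τ

data Concept (τ : Vocab) : Set where
  atom   : Fin (nC τ) → Concept τ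
  nomC   : Fin (nN τ) → Concept τ
  _⊓_    : Concept τ → Concept τ → Concept τ
  _⊔_    : Concept τ → Concept τ → Concept τ
  ¬c_    : Concept τ → Concept τ
  ex     : Role τ → Concept τ → Concept τ
  atMost : ℕ → Role τ → Concept τ → Concept τ

data Formula (τ : Vocab) : Set where
  _⊑_  : Concept τ → Concept τ → Formula τ
  _∧f_ : Formula τ → Formula τ → Formula τ
  _∨f_ : Formula τ → Formula τ → Formula τ
  ¬f_  : Formula τ → Formula τ

module _ {τ : Vocab} (M : Structure τ) where

  roleI : Role τ → Dom M → Dom M → Bool
  roleI (rn r)  x y = role M r x y
  roleI (inv r) x y = role M r y x

  count : (Dom M → Bool) → ℕ
  count p = length (filterᵇ p (allFin (suc (size M))))

  anyD : (Dom M → Bool) → Bool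
  anyD p = not (count p ≤ᵇ 0)

  eqᵇ : Dom M → Dom M → Bool
  eqᵇ x y = Relation.Nullary.Decidable.⌊ x Data.Fin.≟ y ⌋
    where import Data.Fin
          import Relation.Nullary.Decidable

  ⟦_⟧ : Concept τ → Dom M → Bool
  ⟦ atom A ⟧ x       = conc M A x
  ⟦ nomC o ⟧ x       = eqᵇ (nom M o) x
  ⟦ C ⊓ D ⟧ x        = ⟦ C ⟧ x ∧ ⟦ D ⟧ x
  ⟦ C ⊔ D ⟧ x        = ⟦ C ⟧ x ∨ ⟦ D ⟧ x
  ⟦ ¬c C ⟧ x         = not (⟦ C ⟧ x)
  ⟦ ex r C ⟧ x       = anyD (λ y → roleI r x y ∧ ⟦ C ⟧ y)
  ⟦ atMost n r C ⟧ x = count (λ y → roleI r x y ∧ ⟦ C ⟧ y) ≤ᵇ n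

  _⊨_ : Formula τ → Set
  _⊨_ (C ⊑ D)   = ∀ x → ⟦ C ⟧ x ≡ true → ⟦ D ⟧ x ≡ true
  _⊨_ (φ ∧f ψ)  = _⊨_ φ × _⊨_ ψ
  _⊨_ (φ ∨f ψ)  = _⊨_ φ ⊎ _⊨_ ψ
  _⊨_ (¬f φ)    = ¬ (_⊨_ φ)

Models : ∀ {τ} → Structure τ → Formula τ → Set
Models M φ = _⊨_ M φ

record Reach (τ : Vocab) : Set where
  constructor reach
  field
    B : Fin (nC τ)
    S : Subset (nR τ)
    A : Fin (nC τ)
open Reach public

-- Φ = φ ∧ ⋀ RE ∧ ⋀ DI ; RE = {Reach(B_h',S_h',A_h') : h' ∈ Fin h},
-- DI a list of disjointness assertions A₁ ⊓ A₂ ≡ ⊥ (given as pairs).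
record ReFormula (τ : Vocab) : Set where
  field
    φ  : Formula τ
    h  : ℕ
    RE : Fin h → Reach τ
    DI : List (Fin (nC τ) × Fin (nC τ))
open ReFormula public

DeclaredDisjoint : ∀ {τ} → ReFormula τ → Fin (nC τ) → Fin (nC τ) → Set
DeclaredDisjoint Φ A₁ A₂ =
  ((A₁ , A₂) Data.List.Membership.Propositional.∈ DI Φ) ⊎
  ((A₂ , A₁) Data.List.Membership.Propositional.∈ DI Φ)
  where import Data.List.Membership.Propositional

WellFormed : ∀ {τ} → ReFormula τ → Set
WellFormed {τ} Φ =
  (∀ i → S (RE Φ i) ⊆ NF τ) ×
  (∀ i j → ¬ (RE Φ i ≡ RE Φ j) →
     (∃ λ s → s ∈ S (RE Φ i) × s ∈ S (RE Φ j)) →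
     DeclaredDisjoint Φ (A (RE Φ i)) (A (RE Φ j)))

-- assoc(Φ) = φ ∧ ⋀_{h'} (B_h' ⊑ A_h') ∧ ⋀ DI   (its satisfaction, unfolded)

ModelsAssoc : ∀ {τ} → Structure τ → ReFormula τ → Set
ModelsAssoc M Φ =
  Models M (φ Φ) ×
  (∀ i x → conc M (B (RE Φ i)) x ≡ true → conc M (A (RE Φ i)) x ≡ true) ×
  (∀ A₁ A₂ → (A₁ , A₂) Data.List.Membership.Propositional.∈ DI Φ →
     ∀ x → ¬ (conc M A₁ x ≡ true × conc M A₂ x ≡ true))
  where import Data.List.Membership.Propositional

Edge : ∀ {τ} (M : Structure τ) (Φ : ReFormula τ) → Fin (h Φ) → Dom M → Dom M → Set
Edge M Φ i u v =
  conc M (A (RE Φ i)) u ≡ true × conc M (A (RE Φ i)) v ≡ true ×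
  (∃ λ s → s ∈ S (RE Φ i) × role M s u v ≡ true)

SemiConnected : ∀ {τ} → Structure τ → ReFormula τ → Set
SemiConnected M Φ =
  ModelsAssoc M Φ ×
  (∀ i (u : Dom M) → conc M (A (RE Φ i)) u ≡ true →
     ∃ λ (v : Dom M) →
       (conc M (B (RE Φ i)) v ≡ true ⊎ TransClosure (Edge M Φ i) v v) ×
       Star (Edge M Φ i) v u)

-- M is Φ-semi-connected iff assoc(Φ) holds and, for every h', each element of
-- A_{h'} outside B_{h'} has a predecessor in D_{h'}; the latter is the
-- ALCQIO_b inclusion A ⊑ B ⊔ ⨆_{s ∈ S} ∃s⁻.A.  Reachability gives the
-- predecessor as the last edge of the path (or of the cycle, if the path is
-- empty).  Conversely, following predecessors backwards from u either meets
-- B_{h'} or, the structure being finite, revisits a vertex and so closes a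
-- cycle from which u is reachable.
module Submission where

open import Defs

open import Data.Nat using (ℕ; zero; suc; _≤_; _<_; _≤′_; ≤′-refl; ≤′-step; _≤ᵇ_; z<s)
open import Data.Nat.Properties
  using (≤-refl; <⇒≤; n<1+n; z≤′n; m<1+n⇒m<n∨m≡n; m<1+n⇒m≤n; ≤⇒≤′)
open import Data.Bool using (Bool; true; false; _∧_; _∨_; not; T?)
open import Data.Bool.Properties using (∧-conicalˡ; ∧-conicalʳ; ∨-zeroʳ; T-≡)
open import Data.Fin using (Fin; toℕ)
open import Data.Fin.Properties using (pigeonhole; toℕ<n)
open import Data.Fin.Subset using (Subset; _∈_)
open import Data.Fin.Subset.Properties using (_∈?_)
open import Data.List using (List; []; _∷_; _++_; length; map; filter; filterᵇ; foldr; tabulate; allFin)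
open import Data.List.Properties using (filter-some)
open import Data.List.Relation.Unary.All as All using (All)
open import Data.List.Relation.Unary.All.Properties using (++⁺; ++⁻; tabulate⁺; tabulate⁻)
  renaming (map⁺ to All-map⁺; map⁻ to All-map⁻)
open import Data.List.Relation.Unary.Any using (Any; here; there)
open import Data.List.Relation.Unary.Any.Properties using ()
  renaming (map⁺ to Any-map⁺; map⁻ to Any-map⁻)
open import Data.List.Membership.Propositional using (find; lose)
  renaming (_∈_ to _∈ˡ_)
open import Data.List.Membership.Propositional.Properties using (∈-allFin; ∈-filter⁺; ∈-filter⁻)
open import Data.Product using (Σ; _×_; _,_; proj₁; proj₂; ∃)
open import Data.Sum using (_⊎_; inj₁; inj₂)
open import Function using (_∘_)
open import Function.Bundles using (_⇔_; mk⇔; Equivalence)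
import Level
open import Relation.Binary using (Rel)
open import Relation.Binary.PropositionalEquality using (_≡_; refl; sym; trans; cong; cong₂; subst)
open import Relation.Binary.Construct.Closure.ReflexiveTransitive using (Star; ε; _◅_)
open import Relation.Binary.Construct.Closure.Transitive using (TransClosure; [_]; _∷_)
open import Relation.Nullary using (¬_; contradiction)

open Equivalence using (to; from)

lastStep : ∀ {a ℓ} {V : Set a} {R : Rel V ℓ} {x y z} → R x y → Star R y z → ∃ λ w → R w z
lastStep r ε        = _ , r
lastStep _ (r ◅ rs) = lastStep r rs

lastStep⁺ : ∀ {a ℓ} {V : Set a} {R : Rel V ℓ} {x y} → TransClosure R x y → ∃ λ w → R w y
lastStep⁺ [ r ]    = _ , r
lastStep⁺ (r ∷ rs) = lastStep⁺ rs

module _ {a ℓ} {V : Set a} (E : Rel V ℓ) where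

  ReachedFromRootOrCycle : (V → Bool) → V → Set (a Level.⊔ ℓ)
  ReachedFromRootOrCycle Q u = ∃ λ v → (Q v ≡ true ⊎ TransClosure E v v) × Star E v u

  NonRootsHavePredecessors : (P Q : V → Bool) → Set (a Level.⊔ ℓ)
  NonRootsHavePredecessors P Q = ∀ u → P u ≡ true → Q u ≡ false → ∃ λ w → E w u

  predecessor-of-reached : ∀ {Q u} → Q u ≡ false → ReachedFromRootOrCycle Q u → ∃ λ w → E w u
  predecessor-of-reached Qu (_ , inj₁ Qv    , ε)      = contradiction (trans (sym Qv) Qu) λ ()
  predecessor-of-reached Qu (_ , inj₂ cycle , ε)      = lastStep⁺ cycle
  predecessor-of-reached Qu (_ , _          , e ◅ es) = lastStep e es

module _ {m ℓ} (E : Rel (Fin m) ℓ) (P Q : Fin m → Bool)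
         (source-in-P : ∀ {w u} → E w u → P w ≡ true) where

  reached-of-predecessors : NonRootsHavePredecessors E P Q →
                            ∀ u → P u ≡ true → ReachedFromRootOrCycle E Q u
  reached-of-predecessors predecessor u Pu = result
    where
    chosenPredecessor : ∀ v → ∃ λ w → P v ≡ true → Q v ≡ false → E w v
    chosenPredecessor v with P v in Pv | Q v in Qv
    ... | true  | false = let w , e = predecessor v Pv Qv in w , λ _ _ → e
    ... | true  | true  = v , λ _ ()
    ... | false | _     = v , λ ()

    walk : ℕ → Fin m
    walk zero    = u
    walk (suc k) = proj₁ (chosenPredecessor (walk k))

    NoRootBefore : ℕ → Set
    NoRootBefore k = ∀ i → i < k → Q (walk i) ≡ false

    module _ {k} (noRoot : NoRootBefore k) where
      walk-in-P : ∀ i → i ≤ k → P (walk i) ≡ true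
      walk-edge : ∀ i → i < k → E (walk (suc i)) (walk i)
      walk-in-P zero    _   = Pu
      walk-in-P (suc i) i<k = source-in-P (walk-edge i i<k)
      walk-edge i i<k = proj₂ (chosenPredecessor (walk i)) (walk-in-P i (<⇒≤ i<k)) (noRoot i i<k)

      walk-path : ∀ {i j} → i ≤′ j → j ≤ k → Star E (walk j) (walk i)
      walk-path ≤′-refl       _   = ε
      walk-path (≤′-step i≤j) j≤k = walk-edge _ j≤k ◅ walk-path i≤j (<⇒≤ j≤k)

      walk-cycle : ∀ {i j} → suc i ≤′ j → j ≤ k → TransClosure E (walk j) (walk i)
      walk-cycle ≤′-refl       j≤k = [ walk-edge _ j≤k ]
      walk-cycle (≤′-step i<j) j≤k = walk-edge _ j≤k ∷ walk-cycle i<j (<⇒≤ j≤k)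

    noRootBefore-suc : ∀ {k} → NoRootBefore k → Q (walk k) ≡ false → NoRootBefore (suc k)
    noRootBefore-suc noRoot Qk i i<1+k with m<1+n⇒m<n∨m≡n i<1+k
    ... | inj₁ i<k  = noRoot i i<k
    ... | inj₂ refl = Qk

    search : ∀ k → ReachedFromRootOrCycle E Q u ⊎ NoRootBefore k
    search zero = inj₂ λ _ ()
    search (suc k) with search k
    ... | inj₁ reached = inj₁ reached
    ... | inj₂ noRoot with Q (walk k) in Qk
    ...   | true  = inj₁ (walk k , inj₁ Qk , walk-path noRoot z≤′n ≤-refl)
    ...   | false = inj₂ (noRootBefore-suc noRoot Qk)

    result : ReachedFromRootOrCycle E Q u
    result with search m
    ... | inj₁ reached = reached
    ... | inj₂ noRoot  =
      let i , j , i<j , sameVertex = pigeonhole (n<1+n m) (walk ∘ toℕ)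
          j≤m = m<1+n⇒m≤n (toℕ<n j)
          cycle = subst (TransClosure E (walk (toℕ j))) sameVertex
                        (walk-cycle noRoot (≤⇒≤′ i<j) j≤m)
      in walk (toℕ j) , inj₂ cycle , walk-path noRoot z≤′n j≤m

⊥ₐ : ∀ {τ} → Fin (nC τ) → Concept τ
⊥ₐ a = atom a ⊓ (¬c atom a)

-- There is no ⊥ concept, so the empty disjunction is the contradiction ⊥ₐ a on some atom a.
⋁[_]_ : ∀ {τ} → Fin (nC τ) → List (Concept τ) → Concept τ
⋁[ a ] Cs = foldr _⊔_ (⊥ₐ a) Cs

_∧⋀_ : ∀ {τ} → Formula τ → List (Formula τ) → Formula τ
φ ∧⋀ ψs = foldr _∧f_ φ ψs

∧-true⇔ : ∀ {x y} → x ∧ y ≡ true ⇔ (x ≡ true × y ≡ true)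
∧-true⇔ = mk⇔ (λ e → ∧-conicalˡ _ _ e , ∧-conicalʳ _ _ e) (λ (p , q) → cong₂ _∧_ p q)

not-≤ᵇ0⇔0< : ∀ n → not (n ≤ᵇ 0) ≡ true ⇔ 0 < n
not-≤ᵇ0⇔0< zero    = mk⇔ (λ ()) (λ ())
not-≤ᵇ0⇔0< (suc n) = mk⇔ (λ _ → z<s) (λ _ → refl)

nonempty⇒∃∈ : ∀ {a} {A : Set a} {xs : List A} → 0 < length xs → ∃ λ x → x ∈ˡ xs
nonempty⇒∃∈ {xs = x ∷ _} _ = x , here refl

elements : ∀ {n} → Subset n → List (Fin n)
elements S = filter (_∈? S) (allFin _)

∈-elements⇔ : ∀ {n} {S : Subset n} {x} → x ∈ˡ elements S ⇔ x ∈ S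
∈-elements⇔ {S = S} {x} = mk⇔ (proj₂ ∘ ∈-filter⁻ (_∈? S) {xs = allFin _}) (∈-filter⁺ (_∈? S) (∈-allFin x))

inclusionAxiom : ∀ {τ} → Reach τ → Formula τ
inclusionAxiom ρ = atom (B ρ) ⊑ atom (A ρ)

disjointnessAxiom : ∀ {τ} → Fin (nC τ) × Fin (nC τ) → Formula τ
disjointnessAxiom (a₁ , a₂) = (atom a₁ ⊓ atom a₂) ⊑ ⊥ₐ a₁

predecessorAxiom : ∀ {τ} → Reach τ → Formula τ
predecessorAxiom (reach B S A) = atom A ⊑ (⋁[ A ] (atom B ∷ map (λ s → ex (inv s) (atom A)) (elements S)))

assoc : ∀ {τ} → ReFormula τ → Formula τ
assoc Φ = φ Φ ∧⋀ (tabulate (inclusionAxiom ∘ RE Φ) ++ map disjointnessAxiom (DI Φ))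

semi : ∀ {τ} → ReFormula τ → Formula τ
semi Φ = assoc Φ ∧⋀ tabulate (predecessorAxiom ∘ RE Φ)

module _ {τ : Vocab} (M : Structure τ) where

  private
    ⟦_⟧ᴹ : Concept τ → Dom M → Bool
    ⟦_⟧ᴹ = ⟦_⟧ M

  anyD-true⇔ : (p : Dom M → Bool) → anyD M p ≡ true ⇔ ∃ λ y → p y ≡ true
  anyD-true⇔ p = mk⇔ witness nonempty
    where
    witness : anyD M p ≡ true → ∃ λ y → p y ≡ true
    witness any with y , y∈ ← nonempty⇒∃∈ {xs = filterᵇ p (allFin _)} (not-≤ᵇ0⇔0< (count M p) .to any)
      = y , T-≡ .to (proj₂ (∈-filter⁻ (T? ∘ p) {xs = allFin _} y∈))
    nonempty : ∃ (λ y → p y ≡ true) → anyD M p ≡ true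
    nonempty (y , py) = not-≤ᵇ0⇔0< (count M p) .from (filter-some (T? ∘ p) (lose (∈-allFin y) (T-≡ .from py)))

  ⊥ₐ-false : ∀ a x → ⟦ ⊥ₐ a ⟧ᴹ x ≡ false
  ⊥ₐ-false a x with conc M a x
  ... | true  = refl
  ... | false = refl

  ⋁-true⇔ : ∀ a Cs x → ⟦ ⋁[ a ] Cs ⟧ᴹ x ≡ true ⇔ Any (λ C → ⟦ C ⟧ᴹ x ≡ true) Cs
  ⋁-true⇔ a Cs x = mk⇔ (some Cs) (disjunct Cs)
    where
    some : ∀ Cs → ⟦ ⋁[ a ] Cs ⟧ᴹ x ≡ true → Any (λ C → ⟦ C ⟧ᴹ x ≡ true) Cs
    some [] ⊥x = contradiction (trans (sym ⊥x) (⊥ₐ-false a x)) λ ()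
    some (C ∷ Cs) Cs-x with ⟦ C ⟧ᴹ x in Cx
    ... | true  = here Cx
    ... | false = there (some Cs Cs-x)
    disjunct : ∀ Cs → Any (λ C → ⟦ C ⟧ᴹ x ≡ true) Cs → ⟦ ⋁[ a ] Cs ⟧ᴹ x ≡ true
    disjunct (C ∷ Cs) (here Cx)   = cong (_∨ _) Cx
    disjunct (C ∷ Cs) (there any) = trans (cong (⟦ C ⟧ᴹ x ∨_) (disjunct Cs any)) (∨-zeroʳ _)

  ∃⁻-true⇔ : ∀ r C x → ⟦ ex (inv r) C ⟧ᴹ x ≡ true ⇔ ∃ λ y → role M r y x ≡ true × ⟦ C ⟧ᴹ y ≡ true
  ∃⁻-true⇔ r C x = mk⇔ (λ any → let y , e = anyD-true⇔ r⁻C .to any in y , ∧-true⇔ .to e)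
                       (λ (y , e) → anyD-true⇔ r⁻C .from (y , ∧-true⇔ .from e))
    where
    r⁻C : Dom M → Bool
    r⁻C y = role M r y x ∧ ⟦ C ⟧ᴹ y

  ⊨∧⋀⇔ : ∀ φ ψs → Models M (φ ∧⋀ ψs) ⇔ (Models M φ × All (Models M) ψs)
  ⊨∧⋀⇔ φ ψs = mk⇔ (split ψs) (join ψs)
    where
    split : ∀ ψs → Models M (φ ∧⋀ ψs) → Models M φ × All (Models M) ψs
    split []       ⊨φ         = ⊨φ , All.[]
    split (ψ ∷ ψs) (⊨ψ , ⊨ψs) = let ⊨φ , ⊨all = split ψs ⊨ψs in ⊨φ , ⊨ψ All.∷ ⊨all
    join : ∀ ψs → Models M φ × All (Models M) ψs → Models M (φ ∧⋀ ψs)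
    join []       (⊨φ , All.[])         = ⊨φ
    join (ψ ∷ ψs) (⊨φ , ⊨ψ All.∷ ⊨all) = ⊨ψ , join ψs (⊨φ , ⊨all)

  ⊨disjointnessAxiom⇔ : ∀ a₁ a₂ → Models M (disjointnessAxiom (a₁ , a₂)) ⇔
                        (∀ x → ¬ (conc M a₁ x ≡ true × conc M a₂ x ≡ true))
  ⊨disjointnessAxiom⇔ a₁ a₂ =
    mk⇔ (λ ⊨ax x both → contradiction (trans (sym (⊨ax x (∧-true⇔ .from both))) (⊥ₐ-false a₁ x)) λ ())
        (λ disjoint x both → contradiction (∧-true⇔ .to both) (disjoint x))

  module _ (Φ : ReFormula τ) (i : Fin (h Φ)) where
    private
      Aᵢ Bᵢ : Fin (nC τ)
      Aᵢ = A (RE Φ i)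
      Bᵢ = B (RE Φ i)
      predecessorDisjuncts : List (Concept τ)
      predecessorDisjuncts = map (λ s → ex (inv s) (atom Aᵢ)) (elements (S (RE Φ i)))

    ⊨predecessorAxiom⇔ : Models M (predecessorAxiom (RE Φ i)) ⇔
                         NonRootsHavePredecessors (Edge M Φ i) (conc M Aᵢ) (conc M Bᵢ)
    ⊨predecessorAxiom⇔ = mk⇔ predecessor axiom
      where
      predecessor : Models M (predecessorAxiom (RE Φ i)) →
                    NonRootsHavePredecessors (Edge M Φ i) (conc M Aᵢ) (conc M Bᵢ)
      predecessor ⊨ax u Au Bu with ⋁-true⇔ Aᵢ (atom Bᵢ ∷ predecessorDisjuncts) u .to (⊨ax u Au)
      ... | here Bu′ = contradiction (trans (sym Bu′) Bu) λ ()
      ... | there any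
        with s , s∈ , s⁻A ← find (Any-map⁻ any)
        with w , rwu , Aw ← ∃⁻-true⇔ s (atom Aᵢ) u .to s⁻A
        = w , Aw , Au , s , ∈-elements⇔ .to s∈ , rwu
      axiom : NonRootsHavePredecessors (Edge M Φ i) (conc M Aᵢ) (conc M Bᵢ) →
              Models M (predecessorAxiom (RE Φ i))
      axiom preds u Au with conc M Bᵢ u in Bu
      ... | true  = refl
      ... | false with w , (Aw , _ , s , s∈S , rwu) ← preds u Au Bu
        = ⋁-true⇔ Aᵢ predecessorDisjuncts u .from
            (Any-map⁺ (lose (∈-elements⇔ .from s∈S) (∃⁻-true⇔ s (atom Aᵢ) u .from (w , rwu , Aw))))

  ⊨assoc⇔ : ∀ Φ → Models M (assoc Φ) ⇔ ModelsAssoc M Φ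
  ⊨assoc⇔ Φ = mk⇔ split join
    where
    split : Models M (assoc Φ) → ModelsAssoc M Φ
    split ⊨assoc =
      let ⊨φ , ⊨axioms = ⊨∧⋀⇔ _ _ .to ⊨assoc
          ⊨incl , ⊨disj = ++⁻ (tabulate (inclusionAxiom ∘ RE Φ)) ⊨axioms
      in ⊨φ , tabulate⁻ ⊨incl ,
         λ a₁ a₂ a₁a₂∈DI → ⊨disjointnessAxiom⇔ a₁ a₂ .to (All.lookup (All-map⁻ ⊨disj) a₁a₂∈DI)
    join : ModelsAssoc M Φ → Models M (assoc Φ)
    join (⊨φ , ⊨incl , ⊨disj) =
      ⊨∧⋀⇔ _ _ .from (⊨φ , ++⁺ (tabulate⁺ ⊨incl)
        (All-map⁺ (All.tabulate λ a₁a₂∈DI → ⊨disjointnessAxiom⇔ _ _ .from (⊨disj _ _ a₁a₂∈DI))))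

  ⊨semi⇔ : ∀ Φ → Models M (semi Φ) ⇔
           (ModelsAssoc M Φ ×
            ∀ i → NonRootsHavePredecessors (Edge M Φ i) (conc M (A (RE Φ i))) (conc M (B (RE Φ i))))
  ⊨semi⇔ Φ = mk⇔
    (λ ⊨semi → let ⊨assoc , ⊨preds = ⊨∧⋀⇔ _ _ .to ⊨semi
               in ⊨assoc⇔ Φ .to ⊨assoc , λ i → ⊨predecessorAxiom⇔ Φ i .to (tabulate⁻ ⊨preds i))
    (λ (⊨assoc , preds) →
       ⊨∧⋀⇔ _ _ .from (⊨assoc⇔ Φ .from ⊨assoc , tabulate⁺ λ i → ⊨predecessorAxiom⇔ Φ i .from (preds i)))

lemma8 : (τ : Vocab) (Φ : ReFormula τ) → WellFormed Φ →
         Σ (Formula τ) λ semi →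
           (M : Structure τ) → Models M semi ⇔ SemiConnected M Φ
lemma8 τ Φ _ = semi Φ , λ M → mk⇔ (connected M) (axioms M)
  where
  connected : ∀ M → Models M (semi Φ) → SemiConnected M Φ
  connected M ⊨semi =
    let ⊨assoc , preds = ⊨semi⇔ M Φ .to ⊨semi
    in ⊨assoc , λ i → reached-of-predecessors (Edge M Φ i) (conc M (A (RE Φ i))) (conc M (B (RE Φ i)))
                        proj₁ (preds i)
  axioms : ∀ M → SemiConnected M Φ → Models M (semi Φ)
  axioms M (⊨assoc , reached) =
    ⊨semi⇔ M Φ .from (⊨assoc , λ i u Au Bu → predecessor-of-reached (Edge M Φ i) Bu (reached i u Au))
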